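{- For a morphism $f:A\to B$, the following are equivalent: (i) $f$ is reducible; (ii) for every $g\in R^+(A)$, $g;f\in R^+(B)$; (iii) for every $h\in R^-(B)$, $f;h\in R^-(A)$.
   Context: Work in the reduction system on the free classical linear category: objects $A ::= X\mid\mathbf 1\mid\bot\mid A\otimes A\mid A\wp A\mid A^*\mid\,!A$ ($X$ atomic, $\wp$ cotensor); morphisms built from identities, structural isomorphisms, $\partial$, duality morphisms $\tau_A:\mathbf 1\to A\wp A^*$, $\gamma_A:A^*\otimes A\to\bot$ and algebraic morphisms $\tilde\varphi,\varphi_0,\delta,\varepsilon,d,e$ by composition $f;g$ (diagrammatic), $\otimes,\wp,!$, rewritten by 23 oriented rules modulo a congruence. A morphism terminates if it has a finite reduction sequence to a normal form (congruent to a morphism without non-reversible redexes). For $f:A\to B$, $f^*:B^*\to A^*$ is $\rho^{ -1};(1\otimes\tau_A);\partial;((1\otimes f)\wp1);(\gamma_B\wp1);\bar\lambda$. For a set $\mathcal S$ of morphisms into $A$ (resp. out of $A$), $\mathcal S^\bot$ is the set of $g:A\to Y$ (resp. $g:Y\to A$) with $f;g$ (resp. $g;f$) terminating for all $f\in\mathcal S$. With $\mathcal R\otimes\mathcal S=\{f\otimes g\}$, $\mathcal R\wp\mathcal S=\{f\wp g\}$, $!\mathcal S=\{!f\}$, $\mathcal S^*=\{f^*\}$, define: $R^-(X)=\{1_X\}^\bot$ ($X$ atomic), $R^-(\mathbf 1)=\{1_{\mathbf 1}\}^\bot$, $R^+(\bot)=\{1_\bot\}^\bot$, $R^-(A\otimes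 B)=(R^+(A)\otimes R^+(B))^\bot$, $R^+(A\wp B)=(R^-(A)\wp R^-(B))^\bot$, $R^-(A^*)=((R^-(A))^*)^\bot$, $R^-(!A)=(!R^+(A))^\bot$, the other one in each case being the complement. A morphism $f:A\to B$ is reducible if $g;f;h$ terminates for every $g\in R^+(A)$ and $h\in R^-(B)$. -}

module Defs where

open import Data.Nat using (ℕ)
open import Data.Product using (Σ; ∃; _×_; _,_)
open import Relation.Binary.Construct.Closure.ReflexiveTransitive using (Star)

infixr 30 _⊗_ _⅋_
infix 40 _*
infix 45 !_

data Obj : Set where
  atom : ℕ → Obj
  𝟏    : Obj
  ⊥    : Obj
  _⊗_  : Obj → Obj → Obj
  _⅋_  : Obj → Obj → Obj
  _*   : Obj → Obj
  !_   : Obj → Obj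

-- Morphism terms (syntax; equations live in the congruence below)

infixl 20 _⨾_
infixr 30 _⊗ₘ_ _⅋ₘ_

data Hom : Obj → Obj → Set where
  idₘ   : (A : Obj) → Hom A A
  α⊗    : ∀ {A B C} → Hom ((A ⊗ B) ⊗ C) (A ⊗ (B ⊗ C))
  α⊗⁻¹  : ∀ {A B C} → Hom (A ⊗ (B ⊗ C)) ((A ⊗ B) ⊗ C)
  λ⊗    : ∀ {A} → Hom (𝟏 ⊗ A) A
  λ⊗⁻¹  : ∀ {A} → Hom A (𝟏 ⊗ A)
  ρ⊗    : ∀ {A} → Hom (A ⊗ 𝟏) A
  ρ⊗⁻¹  : ∀ {A} → Hom A (A ⊗ 𝟏)
  σ⊗    : ∀ {A B} → Hom (A ⊗ B) (B ⊗ A)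
  α⅋    : ∀ {A B C} → Hom ((A ⅋ B) ⅋ C) (A ⅋ (B ⅋ C))
  α⅋⁻¹  : ∀ {A B C} → Hom (A ⅋ (B ⅋ C)) ((A ⅋ B) ⅋ C)
  λ̄     : ∀ {A} → Hom (⊥ ⅋ A) A
  λ̄⁻¹   : ∀ {A} → Hom A (⊥ ⅋ A)
  ρ̄     : ∀ {A} → Hom (A ⅋ ⊥) A
  ρ̄⁻¹   : ∀ {A} → Hom A (A ⅋ ⊥)
  σ⅋    : ∀ {A B} → Hom (A ⅋ B) (B ⅋ A)
  ∂     : ∀ {A B C} → Hom (A ⊗ (B ⅋ C)) ((A ⊗ B) ⅋ C)
  τ     : (A : Obj) → Hom 𝟏 (A ⅋ (A *))
  γ     : (A : Obj) → Hom ((A *) ⊗ A) ⊥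
  φ̃     : ∀ {A B} → Hom (! A ⊗ ! B) (! (A ⊗ B))
  φ₀    : Hom 𝟏 (! 𝟏)
  δ     : ∀ {A} → Hom (! A) (! ! A)
  ε     : ∀ {A} → Hom (! A) A
  d     : ∀ {A} → Hom (! A) (! A ⊗ ! A)
  e     : ∀ {A} → Hom (! A) 𝟏
  _⨾_   : ∀ {A B C} → Hom A B → Hom B C → Hom A C
  _⊗ₘ_  : ∀ {A B C D} → Hom A B → Hom C D → Hom (A ⊗ C) (B ⊗ D)
  _⅋ₘ_  : ∀ {A B C D} → Hom A B → Hom C D → Hom (A ⅋ C) (B ⅋ D)
  !ₘ    : ∀ {A B} → Hom A B → Hom (! A) (! B)

_ᵗ : ∀ {A B} → Hom A B → Hom (B *) (A *)
_ᵗ {A} {B} f =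
  ρ⊗⁻¹ ⨾ (idₘ (B *) ⊗ₘ τ A) ⨾ ∂ ⨾ ((idₘ (B *) ⊗ₘ f) ⅋ₘ idₘ (A *))
       ⨾ (γ B ⅋ₘ idₘ (A *)) ⨾ λ̄

-- The reduction system, abstracted: a type-preserving one-step rewrite
-- relation (the 23 oriented rules, applied in context) modulo a
-- congruence, plus the predicate "has no non-reversible redex".

record RedSys : Set₁ where
  field
    _⟶_         : ∀ {A B} → Hom A B → Hom A B → Set
    _≈_         : ∀ {A B} → Hom A B → Hom A B → Set
    ≈-refl      : ∀ {A B} {f : Hom A B} → f ≈ f
    ≈-sym       : ∀ {A B} {f g : Hom A B} → f ≈ g → g ≈ f
    ≈-trans     : ∀ {A B} {f g h : Hom A B} → f ≈ g → g ≈ h → f ≈ h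
    ≈-cong-⨾    : ∀ {A B C} {f f' : Hom A B} {g g' : Hom B C} →
                  f ≈ f' → g ≈ g' → (f ⨾ g) ≈ (f' ⨾ g')
    ≈-cong-⊗    : ∀ {A B C D} {f f' : Hom A B} {g g' : Hom C D} →
                  f ≈ f' → g ≈ g' → (f ⊗ₘ g) ≈ (f' ⊗ₘ g')
    ≈-cong-⅋    : ∀ {A B C D} {f f' : Hom A B} {g g' : Hom C D} →
                  f ≈ f' → g ≈ g' → (f ⅋ₘ g) ≈ (f' ⅋ₘ g')
    ≈-cong-!    : ∀ {A B} {f f' : Hom A B} → f ≈ f' → !ₘ f ≈ !ₘ f'
    ≈-assoc     : ∀ {A B C D} {f : Hom A B} {g : Hom B C} {h : Hom C D} →
                  ((f ⨾ g) ⨾ h) ≈ (f ⨾ (g ⨾ h))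
    NoNonRevRedex : ∀ {A B} → Hom A B → Set

module WithRS (RS : RedSys) where
  open RedSys RS

  Step : ∀ {A B} → Hom A B → Hom A B → Set
  Step f g = ∃ λ f' → ∃ λ g' → f ≈ f' × f' ⟶ g' × g' ≈ g

  Normal : ∀ {A B} → Hom A B → Set
  Normal n = ∃ λ m → n ≈ m × NoNonRevRedex m

  Terminates : ∀ {A B} → Hom A B → Set
  Terminates f = ∃ λ n → Star Step f n × Normal n

  OrthIn : ∀ {A} → (∀ {Z} → Hom A Z → Set) → ∀ {Y} → Hom Y A → Set
  OrthIn {A} S g = ∀ {Z} (h : Hom A Z) → S h → Terminates (g ⨾ h)

  OrthOut : ∀ {A} → (∀ {Y} → Hom Y A → Set) → ∀ {Z} → Hom A Z → Set
  OrthOut {A} S h = ∀ {Y} (g : Hom Y A) → S g → Terminates (g ⨾ h)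

  -- The "primary" one of each case is defined
  -- first (membership in ( {1} )^⊥, (R⁺A ⊗ R⁺B)^⊥, … written out), the
  -- other one is its orthogonal.
  R⁺ : (A : Obj) → ∀ {Y} → Hom Y A → Set
  R⁻ : (A : Obj) → ∀ {Z} → Hom A Z → Set
  N-atom : (n : ℕ) → ∀ {Z} → Hom (atom n) Z → Set
  N-𝟏 : ∀ {Z} → Hom 𝟏 Z → Set
  P-⊥ : ∀ {Y} → Hom Y ⊥ → Set
  N-⊗ : (A B : Obj) → ∀ {Z} → Hom (A ⊗ B) Z → Set
  P-⅋ : (A B : Obj) → ∀ {Y} → Hom Y (A ⅋ B) → Set
  N-* : (A : Obj) → ∀ {Z} → Hom (A *) Z → Set
  N-! : (A : Obj) → ∀ {Z} → Hom (! A) Z → Set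

  N-atom n g = Terminates (idₘ (atom n) ⨾ g)
  N-𝟏 g = Terminates (idₘ 𝟏 ⨾ g)
  P-⊥ f = Terminates (f ⨾ idₘ ⊥)
  N-⊗ A B g = ∀ {Y₁ Y₂} (f₁ : Hom Y₁ A) (f₂ : Hom Y₂ B) →
              R⁺ A f₁ → R⁺ B f₂ → Terminates ((f₁ ⊗ₘ f₂) ⨾ g)
  P-⅋ A B f = ∀ {Z₁ Z₂} (h₁ : Hom A Z₁) (h₂ : Hom B Z₂) →
              R⁻ A h₁ → R⁻ B h₂ → Terminates (f ⨾ (h₁ ⅋ₘ h₂))
  N-* A g = ∀ {Y} (h : Hom A Y) → R⁻ A h → Terminates ((h ᵗ) ⨾ g)
  N-! A g = ∀ {Y} (f : Hom Y A) → R⁺ A f → Terminates (!ₘ f ⨾ g)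

  R⁻ (atom n) = N-atom n
  R⁻ 𝟏 = N-𝟏
  R⁻ ⊥ = OrthOut P-⊥
  R⁻ (A ⊗ B) = N-⊗ A B
  R⁻ (A ⅋ B) = OrthOut (P-⅋ A B)
  R⁻ (A *) = N-* A
  R⁻ (! A) = N-! A

  R⁺ (atom n) = OrthIn (N-atom n)
  R⁺ 𝟏 = OrthIn N-𝟏
  R⁺ ⊥ = P-⊥
  R⁺ (A ⊗ B) = OrthIn (N-⊗ A B)
  R⁺ (A ⅋ B) = P-⅋ A B
  R⁺ (A *) = OrthIn (N-* A)
  R⁺ (! A) = OrthIn (N-! A)

  Reducible : ∀ {A B} → Hom A B → Set
  Reducible {A} {B} f = ∀ {Y Z} (g : Hom Y A) (h : Hom B Z) →
                        R⁺ A g → R⁻ B h → Terminates ((g ⨾ f) ⨾ h)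

module Submission where

-- The whole theorem rests on one structural fact about the
-- candidates: at every object A each of R⁺(A), R⁻(A) is exactly the
-- orthogonal of the other,
--     R⁺(A) = R⁻(A)^⊥   and   R⁻(A) = R⁺(A)^⊥ .
-- By definition one of the two is a primary set and the other is its
-- orthogonal; the remaining inclusion is proved by cases on A, testing
-- against the generators of the primary set (identities, tensors /
-- cotensors of candidates, duals, promotions).
-- Granting this, (i) ⇔ (ii) says "g ; f ∈ R⁻(B)^⊥ for all g ∈ R⁺(A)",
-- which is (i) after unfolding; (i) ⇔ (iii) is the same with
-- "f ; h ∈ R⁺(A)^⊥", up to reassociating (g ; f) ; h ≈ g ; (f ; h), under
-- which termination is invariant.

open import Defs
open import Data.Product using (_×_; _,_)
open import Function.Bundles using (_⇔_; mk⇔; Equivalence)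
open import Relation.Binary.Construct.Closure.ReflexiveTransitive using (ε; _◅_)

module _ (RS : RedSys) where
  open RedSys RS
  open WithRS RS

  -- Termination only depends on the morphism up to the congruence: the
  -- first step (or the normal form) is itself taken modulo ≈.
  terminates-resp-≈ : ∀ {A B} {f f' : Hom A B} → f ≈ f' → Terminates f' → Terminates f
  terminates-resp-≈ f≈f' (_ , ε , (m , n≈m , m-normal)) =
    _ , ε , (m , ≈-trans f≈f' n≈m , m-normal)
  terminates-resp-≈ f≈f' (n , (x , y , f'≈x , x⟶y , y≈z) ◅ steps , n-normal) =
    n , (x , y , ≈-trans f≈f' f'≈x , x⟶y , y≈z) ◅ steps , n-normal

  -- At every object one side is by
  -- definition the orthogonal of a set containing the other.
  adequacy : ∀ A {Y Z} (g : Hom Y A) (h : Hom A Z) →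
             R⁺ A g → R⁻ A h → Terminates (g ⨾ h)
  adequacy (atom n) g h g⁺ h⁻ = g⁺ h h⁻
  adequacy 𝟏       g h g⁺ h⁻ = g⁺ h h⁻
  adequacy ⊥       g h g⁺ h⁻ = h⁻ g g⁺
  adequacy (A ⊗ B) g h g⁺ h⁻ = g⁺ h h⁻
  adequacy (A ⅋ B) g h g⁺ h⁻ = h⁻ g g⁺
  adequacy (A *)   g h g⁺ h⁻ = g⁺ h h⁻
  adequacy (! A)   g h g⁺ h⁻ = g⁺ h h⁻

  -- R⁻(A)^⊥ ⊆ R⁺(A).  Where R⁺(A) is the primary set, test g against
  -- the negative candidate generating it: 1_⊥ for ⊥, h₁ ⅋ h₂ for A ⅋ B.
  R⁺-intro : ∀ A {Y} (g : Hom Y A) → OrthIn (R⁻ A) g → R⁺ A g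
  R⁺-intro (atom n) g g⊥ = g⊥
  R⁺-intro 𝟏       g g⊥ = g⊥
  R⁺-intro ⊥       g g⊥ = g⊥ (idₘ ⊥) (λ _ k⁺ → k⁺)
  R⁺-intro (A ⊗ B) g g⊥ = g⊥
  R⁺-intro (A ⅋ B) g g⊥ = λ h₁ h₂ h₁⁻ h₂⁻ →
    g⊥ (h₁ ⅋ₘ h₂) (λ _ k⁺ → k⁺ h₁ h₂ h₁⁻ h₂⁻)
  R⁺-intro (A *)   g g⊥ = g⊥
  R⁺-intro (! A)   g g⊥ = g⊥

  -- R⁺(A)^⊥ ⊆ R⁻(A).  Where R⁻(A) is the primary set, test h against
  -- the positive candidate generating it: 1_X, 1_𝟏, f₁ ⊗ f₂, k*, !f.
  R⁻-intro : ∀ A {Z} (h : Hom A Z) → OrthOut (R⁺ A) h → R⁻ A h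
  R⁻-intro (atom n) h h⊥ = h⊥ (idₘ (atom n)) (λ _ k⁻ → k⁻)
  R⁻-intro 𝟏       h h⊥ = h⊥ (idₘ 𝟏) (λ _ k⁻ → k⁻)
  R⁻-intro ⊥       h h⊥ = h⊥
  R⁻-intro (A ⊗ B) h h⊥ = λ f₁ f₂ f₁⁺ f₂⁺ →
    h⊥ (f₁ ⊗ₘ f₂) (λ _ k⁻ → k⁻ f₁ f₂ f₁⁺ f₂⁺)
  R⁻-intro (A ⅋ B) h h⊥ = h⊥
  R⁻-intro (A *)   h h⊥ = λ k k⁻ → h⊥ (k ᵗ) (λ _ n⁻ → n⁻ k k⁻)
  R⁻-intro (! A)   h h⊥ = λ f f⁺ → h⊥ (!ₘ f) (λ _ n⁻ → n⁻ f f⁺)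

  R⁺-is-orthogonal : ∀ A {Y} (g : Hom Y A) → R⁺ A g ⇔ OrthIn (R⁻ A) g
  R⁺-is-orthogonal A g = mk⇔ (λ g⁺ {Z} h h⁻ → adequacy A g h g⁺ h⁻) (R⁺-intro A g)

  R⁻-is-orthogonal : ∀ A {Z} (h : Hom A Z) → R⁻ A h ⇔ OrthOut (R⁺ A) h
  R⁻-is-orthogonal A h = mk⇔ (λ h⁻ {Y} g g⁺ → adequacy A g h g⁺ h⁻) (R⁻-intro A h)

  reducible⇔pushes-R⁺ : ∀ {A B} (f : Hom A B) →
    Reducible f ⇔ (∀ {Y} (g : Hom Y A) → R⁺ A g → R⁺ B (g ⨾ f))
  reducible⇔pushes-R⁺ {A} {B} f = mk⇔
    (λ f-red {Y} g g⁺ → from (R⁺-is-orthogonal B (g ⨾ f)) (λ {Z} h h⁻ → f-red g h g⁺ h⁻))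
    (λ push {Y} {Z} g h g⁺ h⁻ → to (R⁺-is-orthogonal B (g ⨾ f)) (push g g⁺) h h⁻)
    where open Equivalence

  reducible⇔pulls-R⁻ : ∀ {A B} (f : Hom A B) →
    Reducible f ⇔ (∀ {Z} (h : Hom B Z) → R⁻ B h → R⁻ A (f ⨾ h))
  reducible⇔pulls-R⁻ {A} {B} f = mk⇔
    (λ f-red {Z} h h⁻ → from (R⁻-is-orthogonal A (f ⨾ h)) (λ {Y} g g⁺ →
      terminates-resp-≈ (≈-sym ≈-assoc) (f-red g h g⁺ h⁻)))
    (λ pull {Y} {Z} g h g⁺ h⁻ →
      terminates-resp-≈ ≈-assoc (to (R⁻-is-orthogonal A (f ⨾ h)) (pull h h⁻) g g⁺))
    where open Equivalence

mainTheorem7 : (RS : RedSys) → ∀ {A B} (f : Hom A B) →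
    (WithRS.Reducible RS f ⇔
      (∀ {Y} (g : Hom Y A) → WithRS.R⁺ RS A g → WithRS.R⁺ RS B (g ⨾ f)))
    × (WithRS.Reducible RS f ⇔
      (∀ {Z} (h : Hom B Z) → WithRS.R⁻ RS B h → WithRS.R⁻ RS A (f ⨾ h)))
mainTheorem7 RS f = reducible⇔pushes-R⁺ RS f , reducible⇔pulls-R⁻ RS f
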